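{- Let $m,n>1$ be integers such that $p=\gcd(m,n)$ is an odd prime. For every $\beta\in\{1,2,\dots,p-1\}$, the set $\rho^{ -1}(\ell^\beta)$ is a line on $T_{m\times n}$, where $\ell^\beta=\{\pi_{p,p}(k,\beta k):k\in\mathbb Z\}\subset T_{p\times p}$.
   Context: For integers $m,n>1$, the discrete torus is $T_{m\times n}=\{0,\dots,m-1\}\times\{0,\dots,n-1\}$, with projection $\pi_{m,n}:\mathbb Z\times\mathbb Z\to T_{m\times n}$, $\pi_{m,n}(a,b)=(a \bmod m,\ b\bmod n)$ (least non-negative remainders); similarly for $T_{p\times p}$ and $\pi_{p,p}$. A line in $\mathbb Z\times\mathbb Z$ is a set $\{(a+uk,b+vk):k\in\mathbb Z\}$ with $a,b,u,v\in\mathbb Z$ and $\gcd(u,v)=1$. A line on $T_{m\times n}$ is the image under $\pi_{m,n}$ of a line in $\mathbb Z\times\mathbb Z$. The map $\rho:T_{m\times n}\to T_{p\times p}$ is $\rho(u,v)=(u\bmod p, v\bmod p)$. -}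

module Defs where

open import Data.Nat as ℕ using (ℕ; zero; suc; _<_)
open import Data.Nat.DivMod using (_%_)
open import Data.Integer as ℤ using (ℤ; +_; _%ℕ_)
open import Data.Integer.GCD using (gcd)
open import Data.Product using (_×_; _,_; ∃-syntax)
open import Function.Bundles using (_⇔_)
open import Relation.Binary.PropositionalEquality using (_≡_)

-- Least non-negative remainder of an integer modulo a natural number.
-- (The modulus 0 case is never used: all moduli in the statement are > 1.)
_modℤ_ : ℤ → ℕ → ℕ
a modℤ zero    = 0
a modℤ (suc n) = a %ℕ suc n

_modℕ_ : ℕ → ℕ → ℕ
a modℕ zero    = 0
a modℕ (suc n) = a % suc n

-- Points of the discrete torus T_{m×n} are pairs (x , y) of naturals with
-- x < m and y < n; subsets of T_{m×n} are predicates on ℕ × ℕ that only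
-- hold of such pairs.
Point : Set
Point = ℕ × ℕ

Subset : Set₁
Subset = Point → Set

π : ℕ → ℕ → ℤ × ℤ → Point
π m n (a , b) = (a modℤ m , b modℤ n)

ρ : ℕ → Point → Point
ρ p (x , y) = (x modℕ p , y modℕ p)

IsLineOn : ℕ → ℕ → Subset → Set
IsLineOn m n S =
  ∃[ a ] ∃[ b ] ∃[ u ] ∃[ v ]
    (gcd u v ≡ + 1 ×
     (∀ z → S z ⇔ (∃[ k ] π m n (a ℤ.+ u ℤ.* k , b ℤ.+ v ℤ.* k) ≡ z)))

ℓ : ℕ → ℕ → Subset
ℓ p β z = ∃[ k ] π p p (k , + β ℤ.* k) ≡ z

ρ⁻¹ : ℕ → ℕ → ℕ → Subset → Subset
ρ⁻¹ m n p L (x , y) = x < m × y < n × L (ρ p (x , y))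

-- Write m = m₁p and n = n₁p with m₁, n₁ coprime; then ρ⁻¹(ℓ^β) is the set of torus points
-- (x, y) with y ≡ βx (mod p). The prime p is coprime to n₁ or to m₁. In the first case take
-- v ≡ β (mod p) and v ≡ 1 (mod n₁) by the Chinese remainder theorem. The line k ↦ (k, vk)
-- stays in the set because v ≡ β (mod p). It reaches a point (x, y) of the set: y − vx = hp,
-- and moving from k = x by m·j changes vk by v·m₁·j·p ≡ m₁·j·p (mod n₁p), so choosing
-- j ≡ h·m₁⁻¹ (mod n₁) hits y. The second case is the first with the axes exchanged and β
-- replaced by its inverse modulo p.
module Submission where

open import Defs
open import Data.Integer as ℤ
  using (ℤ; +_; 0ℤ; 1ℤ; _+_; _-_; -_; _*_; ∣_∣; _/ℕ_)
open import Data.Integer.DivMod using (n%ℕd<d; a≡a%ℕn+[a/ℕn]*n)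
open import Data.Integer.Divisibility.Signed
open import Data.Integer.GCD using (gcd-comm; gcd-zeroˡ) renaming (gcd to gcdℤ)
open import Data.Integer.Properties
  using (+-injective; +-inverseʳ; +-identityˡ; *-identityˡ; *-identityʳ; *-assoc; *-comm;
         pos-+; pos-*; neg-distribˡ-*; i-j≡0⇒i≡j; ∣i∣≡0⇒i≡0; [+m]-[+n]≡m⊖n; ∣m⊝n∣≤m⊔n)
open import Data.Integer.Tactic.RingSolver using (solve-∀; solve)
open import Data.List.Base using (_∷_; [])
open import Data.Nat.Base as ℕ using (ℕ; suc; _<_; _≤_; NonZero; >-nonZero; ≢-nonZero)
open import Data.Nat.Coprimality using (Coprime; coprime-Bézout; coprime-/gcd; prime⇒coprime)
  renaming (sym to coprime-sym)
open import Data.Nat.DivMod using (_/_; m<n⇒m%n≡m; m/n*n≡m)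
open import Data.Nat.Divisibility as ℕ using (n∣m⇒m%n≡0)
open import Data.Nat.GCD using (gcd; gcd[m,n]∣m; gcd[m,n]∣n; module Bézout)
open import Data.Nat.Primality using (Prime; prime⇒irreducible; prime⇒nonZero; ¬prime[1])
open import Data.Nat.Properties using (≤-<-trans; ⊔-pres-<m; m<n⇒n≢0)
open import Data.Product using (_×_; _,_; ∃-syntax; map₂; swap)
open import Data.Product.Properties using (,-injectiveˡ; ,-injectiveʳ)
open import Data.Sum using (_⊎_; inj₁; inj₂; [_,_]′)
open import Function.Base using (_∘_; _$_)
open import Function.Bundles using (_⇔_; mk⇔; module Equivalence)
open import Function.Properties.Equivalence using () renaming (sym to ⇔-sym; trans to ⇔-trans)
open import Level using (0ℓ)
open import Relation.Binary.Bundles using (Setoid)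
open import Relation.Binary.PropositionalEquality
open import Relation.Nullary using (¬_; yes; no; contradiction)
import Relation.Binary.Reasoning.Setoid as SetoidReasoning

open Equivalence using (to; from)

infix 4 _≡_mod_

-- A record rather than an abbreviation of  + d ∣ a - b,  so that a, b and d are inferable.
record _≡_mod_ (a b : ℤ) (d : ℕ) : Set where
  constructor ∣⇒≡mod
  field ≡mod⇒∣ : + d ∣ a - b

open _≡_mod_

private variable
  a b c : ℤ
  d e : ℕ

-- Opaque: witnesses such as the one in ≡mod⇒line-point are built from quotients of these
-- proofs, and letting the type checker unfold the ring-solver terms makes checking explode.
opaque
  ≡⇒≡mod : a ≡ b → a ≡ b mod d
  ≡⇒≡mod {a} refl = ∣⇒≡mod (divides 0ℤ (+-inverseʳ a))

  ≡+multiple⇒≡mod : ∀ q → a ≡ b + q * + d → a ≡ b mod d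
  ≡+multiple⇒≡mod {b = b} {d} q refl = ∣⇒≡mod (divides q (b+c-b≡c b (q * + d)))
    where
    b+c-b≡c : ∀ b c → b + c - b ≡ c
    b+c-b≡c = solve-∀

  ≡mod-sym : a ≡ b mod d → b ≡ a mod d
  ≡mod-sym {a} {b} {d} (∣⇒≡mod a≡b) = ∣⇒≡mod $ begin
    + d       ∣⟨ ∣m⇒∣-m a≡b ⟩
    - (a - b) ≡⟨ solve (a ∷ b ∷ []) ⟩
    b - a     ∎
    where open ∣-Reasoning

  ≡mod-trans : a ≡ b mod d → b ≡ c mod d → a ≡ c mod d
  ≡mod-trans {a} {b} {d} {c} (∣⇒≡mod a≡b) (∣⇒≡mod b≡c) = ∣⇒≡mod $ begin
    + d             ∣⟨ ∣m∣n⇒∣m+n a≡b b≡c ⟩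
    a - b + (b - c) ≡⟨ solve (a ∷ b ∷ c ∷ []) ⟩
    a - c           ∎
    where open ∣-Reasoning

  *-distribˡ-minus : ∀ c a b → c * (a - b) ≡ c * a - c * b
  *-distribˡ-minus = solve-∀

  +-congˡ-mod : ∀ c → a ≡ b mod d → c + a ≡ c + b mod d
  +-congˡ-mod {a} {b} {d} c (∣⇒≡mod a≡b) = ∣⇒≡mod $ begin
    + d             ∣⟨ a≡b ⟩
    a - b           ≡⟨ solve (a ∷ b ∷ c ∷ []) ⟩
    c + a - (c + b) ∎
    where open ∣-Reasoning

  *-congˡ-mod : ∀ c → a ≡ b mod d → c * a ≡ c * b mod d
  *-congˡ-mod {a} {b} {d} c (∣⇒≡mod a≡b) = ∣⇒≡mod $ begin
    + d           ∣⟨ ∣n⇒∣m*n c a≡b ⟩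
    c * (a - b)   ≡⟨ *-distribˡ-minus c a b ⟩
    c * a - c * b ∎
    where open ∣-Reasoning

  *-congʳ-mod : ∀ c → a ≡ b mod d → a * c ≡ b * c mod d
  *-congʳ-mod {a} {b} {d} c (∣⇒≡mod a≡b) = ∣⇒≡mod $ begin
    + d           ∣⟨ ∣m⇒∣m*n c a≡b ⟩
    (a - b) * c   ≡⟨ solve (a ∷ b ∷ c ∷ []) ⟩
    a * c - b * c ∎
    where open ∣-Reasoning

  *-scale-mod : ∀ e → a ≡ b mod d → + e * a ≡ + e * b mod (d ℕ.* e)
  *-scale-mod {a} {b} {d} e (∣⇒≡mod a≡b) = ∣⇒≡mod $ begin
    + (d ℕ.* e)       ≡⟨ pos-* d e ⟩
    + d * + e         ≡⟨ *-comm (+ d) (+ e) ⟩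
    + e * + d         ∣⟨ *-monoʳ-∣ (+ e) a≡b ⟩
    + e * (a - b)     ≡⟨ *-distribˡ-minus (+ e) a b ⟩
    + e * a - + e * b ∎
    where open ∣-Reasoning

  ≡mod-divisor : e ℕ.∣ d → a ≡ b mod d → a ≡ b mod e
  ≡mod-divisor e∣d (∣⇒≡mod d∣a-b) = ∣⇒≡mod (∣-trans (∣ᵤ⇒∣ e∣d) d∣a-b)

≡mod-setoid : ℕ → Setoid 0ℓ 0ℓ
≡mod-setoid d = record
  { Carrier       = ℤ
  ; _≈_           = λ a b → a ≡ b mod d
  ; isEquivalence = record { refl = ≡⇒≡mod refl ; sym = ≡mod-sym ; trans = ≡mod-trans }
  }

module ≡mod-Reasoning (d : ℕ) = SetoidReasoning (≡mod-setoid d)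

∣∧<⇒≡0 : .{{NonZero d}} → d ℕ.∣ e → e < d → e ≡ 0
∣∧<⇒≡0 {d} {e} d∣e e<d = trans (sym (m<n⇒m%n≡m e<d)) (n∣m⇒m%n≡0 e d d∣e)

remainder-unique : .{{NonZero d}} → ∀ {r r'} → r < d → r' < d → + r ≡ + r' mod d → r ≡ r'
remainder-unique {d} {r} {r'} r<d r'<d r≡r' =
  +-injective (i-j≡0⇒i≡j (+ r) (+ r') (∣i∣≡0⇒i≡0 (∣∧<⇒≡0 (∣⇒∣ᵤ (≡mod⇒∣ r≡r')) ∣r-r'∣<d)))
  where
  ∣r-r'∣<d : ∣ + r - + r' ∣ < d
  ∣r-r'∣<d = subst (_< d) (cong ∣_∣ (sym ([+m]-[+n]≡m⊖n r r')))
               (≤-<-trans (∣m⊝n∣≤m⊔n r r') (⊔-pres-<m r<d r'<d))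

modℤ<d : ∀ z d .{{_ : NonZero d}} → z modℤ d < d
modℤ<d z (suc d) = n%ℕd<d z (suc d)

≡modℤ : ∀ z d .{{_ : NonZero d}} → z ≡ + (z modℤ d) mod d
≡modℤ z (suc d) = ≡+multiple⇒≡mod (z /ℕ suc d) (a≡a%ℕn+[a/ℕn]*n z (suc d))

modℤ≡⇔ : ∀ {z r} d .{{_ : NonZero d}} → z modℤ d ≡ r ⇔ (r < d × z ≡ + r mod d)
modℤ≡⇔ {z} d = mk⇔ (λ { refl → modℤ<d z d , ≡modℤ z d })
  (λ (r<d , z≡r) → remainder-unique (modℤ<d z d) r<d (≡mod-trans (≡mod-sym (≡modℤ z d)) z≡r))

modℤ-cong⇔ : ∀ {a b} d .{{_ : NonZero d}} → a modℤ d ≡ b modℤ d ⇔ (a ≡ b mod d)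
modℤ-cong⇔ {a} {b} d = mk⇔
  (λ eq → ≡mod-trans (≡modℤ a d) (subst (λ r → + r ≡ b mod d) (sym eq) (≡mod-sym (≡modℤ b d))))
  (λ a≡b → from (modℤ≡⇔ d) (modℤ<d b d , ≡mod-trans a≡b (≡modℤ b d)))

pos-1+* : ∀ m n → + (1 ℕ.+ m ℕ.* n) ≡ 1ℤ + + m * + n
pos-1+* m n = trans (pos-+ 1 (m ℕ.* n)) (cong (_+_ 1ℤ) (pos-* m n))

coprime⇒invertible : ∀ {a b} → Coprime a b → ∃[ w ] w * + a ≡ 1ℤ mod b
coprime⇒invertible {a} {b} cop with coprime-Bézout cop
... | Bézout.+- x y 1+yb≡xa = + x , ≡+multiple⇒≡mod (+ y) (begin
  + x * + a         ≡⟨ pos-* x a ⟨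
  + (x ℕ.* a)       ≡⟨ cong +_ 1+yb≡xa ⟨
  + (1 ℕ.+ y ℕ.* b) ≡⟨ pos-1+* y b ⟩
  1ℤ + + y * + b    ∎)
  where open ≡-Reasoning
... | Bézout.-+ x y 1+xa≡yb = - + x , ≡+multiple⇒≡mod (- + y) (begin
  - + x * + a            ≡⟨ negate-via-1+ (+ x) (+ a) ⟩
  1ℤ - (1ℤ + + x * + a)  ≡⟨ cong (λ t → 1ℤ - t) (pos-1+* x a) ⟨
  1ℤ - + (1 ℕ.+ x ℕ.* a) ≡⟨ cong (λ t → 1ℤ - + t) 1+xa≡yb ⟩
  1ℤ - + (y ℕ.* b)       ≡⟨ cong (λ t → 1ℤ - t) (pos-* y b) ⟩
  1ℤ - + y * + b         ≡⟨ cong (_+_ 1ℤ) (neg-distribˡ-* (+ y) (+ b)) ⟩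
  1ℤ + - + y * + b       ∎)
  where
  open ≡-Reasoning
  negate-via-1+ : ∀ x a → - x * a ≡ 1ℤ - (1ℤ + x * a)
  negate-via-1+ = solve-∀

chinese-remainder : ∀ {a b} → Coprime a b → ∀ c e → ∃[ v ] (v ≡ c mod a × v ≡ e mod b)
chinese-remainder {a} {b} cop c e with coprime⇒invertible cop
... | w , wa≡1 =
  c + (e - c) * (w * + a) ,
  ≡+multiple⇒≡mod ((e - c) * w) (cong (_+_ c) (sym (*-assoc (e - c) w (+ a)))) ,
  (begin
    c + (e - c) * (w * + a) ≈⟨ +-congˡ-mod c (*-congˡ-mod (e - c) wa≡1) ⟩
    c + (e - c) * 1ℤ        ≡⟨ solve (c ∷ e ∷ []) ⟩
    e                       ∎)
  where open ≡mod-Reasoning b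

prime∤⇒coprime : ∀ {p a} → Prime p → ¬ p ℕ.∣ a → Coprime p a
prime∤⇒coprime pr p∤a (d∣p , d∣a) with prime⇒irreducible pr d∣p
... | inj₁ d≡1 = d≡1
... | inj₂ refl = contradiction d∣a p∤a

prime⇒coprime⊎coprime : ∀ {p a b} → Prime p → Coprime a b → Coprime p a ⊎ Coprime p b
prime⇒coprime⊎coprime {p} {a} {b} pr cop with p ℕ.∣? b
... | no p∤b = inj₂ (prime∤⇒coprime pr p∤b)
... | yes p∣b = inj₁ (prime∤⇒coprime pr λ p∣a → ¬prime[1] (subst Prime (cop (p∣a , p∣b)) pr))

ℓ-reduction⇔ : ∀ {p β x y} .{{_ : NonZero p}} →
               ℓ p β (x modℕ p , y modℕ p) ⇔ (+ y ≡ + β * + x mod p)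
ℓ-reduction⇔ {p@(suc _)} {β} {x} {y} = mk⇔
  (λ (k , eq) → begin
    + y     ≈⟨ ≡mod-sym (to (modℤ-cong⇔ p) (,-injectiveʳ eq)) ⟩
    + β * k ≈⟨ *-congˡ-mod (+ β) (to (modℤ-cong⇔ p) (,-injectiveˡ eq)) ⟩
    + β * + x ∎)
  (λ y≡βx → + x , cong (x modℕ p ,_) (from (modℤ-cong⇔ p) (≡mod-sym y≡βx)))
  where open ≡mod-Reasoning p

CongruenceLine : ℕ → ℕ → ℕ → ℤ → Subset
CongruenceLine m n p β (x , y) = x < m × y < n × + y ≡ β * + x mod p

ρ⁻¹ℓ⇔congruenceLine : ∀ {m n p β} .{{_ : NonZero p}} z →
                      ρ⁻¹ m n p (ℓ p β) z ⇔ CongruenceLine m n p (+ β) z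
ρ⁻¹ℓ⇔congruenceLine {p = p} {β} _ =
  mk⇔ (map₂ (map₂ (to (ℓ-reduction⇔ {p} {β})))) (map₂ (map₂ (from (ℓ-reduction⇔ {p} {β}))))

isLineOn-resp-⇔ : ∀ {m n S T} → (∀ z → S z ⇔ T z) → IsLineOn m n S → IsLineOn m n T
isLineOn-resp-⇔ S⇔T (a , b , u , v , gcd≡1 , S⇔line) =
  a , b , u , v , gcd≡1 , λ z → ⇔-trans (⇔-sym (S⇔T z)) (S⇔line z)

isLineOn-swap : ∀ {m n S} → IsLineOn m n S → IsLineOn n m (S ∘ swap)
isLineOn-swap (a , b , u , v , gcd≡1 , S⇔line) = b , a , v , u , trans (gcd-comm v u) gcd≡1 , λ z →
  mk⇔ (λ Sz → let k , eq = to (S⇔line (swap z)) Sz in k , cong swap eq)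
      (λ (k , eq) → from (S⇔line (swap z)) (k , cong swap eq))

π-origin-line⇔ : ∀ {m n} .{{_ : NonZero m}} .{{_ : NonZero n}} u v x y →
  (∃[ k ] π m n (0ℤ + u * k , 0ℤ + v * k) ≡ (x , y)) ⇔
  (x < m × y < n × ∃[ k ] (u * k ≡ + x mod m × v * k ≡ + y mod n))
π-origin-line⇔ {m} {n} u v x y = mk⇔
  (λ (k , eq) → let x<m , uk≡x = to (modℤ≡⇔ m) (,-injectiveˡ (trans (sym (π-origin k)) eq))
                    y<n , vk≡y = to (modℤ≡⇔ n) (,-injectiveʳ (trans (sym (π-origin k)) eq))
                in  x<m , y<n , k , uk≡x , vk≡y)
  (λ (x<m , y<n , k , uk≡x , vk≡y) →
     k , trans (π-origin k) (cong₂ _,_ (from (modℤ≡⇔ m) (x<m , uk≡x)) (from (modℤ≡⇔ n) (y<n , vk≡y))))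
  where
  π-origin : ∀ k → π m n (0ℤ + u * k , 0ℤ + v * k) ≡ ((u * k) modℤ m , (v * k) modℤ n)
  π-origin k = cong₂ (λ a b → (a modℤ m , b modℤ n)) (+-identityˡ (u * k)) (+-identityˡ (v * k))

isLineOn-through-origin : ∀ {m n S} .{{_ : NonZero m}} .{{_ : NonZero n}} u v → gcdℤ u v ≡ 1ℤ →
  (∀ x y → S (x , y) ⇔ (x < m × y < n × ∃[ k ] (u * k ≡ + x mod m × v * k ≡ + y mod n))) →
  IsLineOn m n S
isLineOn-through-origin u v gcd≡1 S⇔ =
  0ℤ , 0ℤ , u , v , gcd≡1 , λ (x , y) → ⇔-trans (S⇔ x y) (⇔-sym (π-origin-line⇔ u v x y))

line-point⇒≡mod : ∀ {p m n k X Y} v → p ℕ.∣ m → p ℕ.∣ n →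
                  k ≡ X mod m → v * k ≡ Y mod n → Y ≡ v * X mod p
line-point⇒≡mod {p} {k = k} {X} {Y} v p∣m p∣n k≡X vk≡Y = begin
  Y     ≈⟨ ≡mod-sym (≡mod-divisor p∣n vk≡Y) ⟩
  v * k ≈⟨ *-congˡ-mod v (≡mod-divisor p∣m k≡X) ⟩
  v * X ∎
  where open ≡mod-Reasoning p

≡mod⇒line-point : ∀ {m₁ n₁ p w X Y} v → w * (v * + m₁) ≡ 1ℤ mod n₁ → Y ≡ v * X mod p →
                  ∃[ k ] (k ≡ X mod (m₁ ℕ.* p) × v * k ≡ Y mod (n₁ ℕ.* p))
≡mod⇒line-point {m₁} {n₁} {p} {w} {X} {Y} v wvm₁≡1 (∣⇒≡mod (divides h Y-vX≡hp)) =
  X + + (m₁ ℕ.* p) * (w * h) ,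
  ≡+multiple⇒≡mod (w * h) (cong (_+_ X) (*-comm (+ (m₁ ℕ.* p)) (w * h))) ,
  (begin
    v * (X + + (m₁ ℕ.* p) * (w * h))     ≡⟨ cong (λ t → v * (X + t * (w * h))) (pos-* m₁ p) ⟩
    v * (X + + m₁ * + p * (w * h))       ≡⟨ rearrange v X w h (+ m₁) (+ p) ⟩
    v * X + h * (+ p * (w * (v * + m₁))) ≈⟨ +-congˡ-mod (v * X) (*-congˡ-mod h (*-scale-mod p wvm₁≡1)) ⟩
    v * X + h * (+ p * 1ℤ)               ≡⟨ cong (λ t → v * X + h * t) (*-identityʳ (+ p)) ⟩
    v * X + h * + p                      ≡⟨ cong (_+_ (v * X)) Y-vX≡hp ⟨
    v * X + (Y - v * X)                  ≡⟨ solve (v ∷ X ∷ Y ∷ []) ⟩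
    Y                                    ∎)
  where
  open ≡mod-Reasoning (n₁ ℕ.* p)
  rearrange : ∀ v X w h M P → v * (X + M * P * (w * h)) ≡ v * X + h * (P * (w * (v * M)))
  rearrange = solve-∀

isLineOn-congruenceLine-along : ∀ {m₁ n₁ p β w} .{{_ : NonZero (m₁ ℕ.* p)}} .{{_ : NonZero (n₁ ℕ.* p)}} →
  ∀ v → v ≡ β mod p → v ≡ 1ℤ mod n₁ → w * + m₁ ≡ 1ℤ mod n₁ →
  IsLineOn (m₁ ℕ.* p) (n₁ ℕ.* p) (CongruenceLine (m₁ ℕ.* p) (n₁ ℕ.* p) p β)
isLineOn-congruenceLine-along {m₁} {n₁} {p} {β} {w} v v≡β v≡1 wm₁≡1 =
  isLineOn-through-origin 1ℤ v (gcd-zeroˡ v) λ x y →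
    mk⇔ (map₂ (map₂ (to (on-line⇔ (+ x) (+ y))))) (map₂ (map₂ (from (on-line⇔ (+ x) (+ y)))))
  where
  wvm₁≡1 : w * (v * + m₁) ≡ 1ℤ mod n₁
  wvm₁≡1 = begin
    w * (v * + m₁)  ≈⟨ *-congˡ-mod w (*-congʳ-mod (+ m₁) v≡1) ⟩
    w * (1ℤ * + m₁) ≡⟨ cong (w *_) (*-identityˡ (+ m₁)) ⟩
    w * + m₁        ≈⟨ wm₁≡1 ⟩
    1ℤ              ∎
    where open ≡mod-Reasoning n₁

  βX≡vX : ∀ X → β * X ≡ v * X mod p
  βX≡vX X = *-congʳ-mod X (≡mod-sym v≡β)

  on-line⇔ : ∀ X Y → (Y ≡ β * X mod p) ⇔
             (∃[ k ] (1ℤ * k ≡ X mod (m₁ ℕ.* p) × v * k ≡ Y mod (n₁ ℕ.* p)))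
  on-line⇔ X Y = mk⇔
    (λ Y≡βX → let k , k≡X , vk≡Y = ≡mod⇒line-point {m₁} {w = w} v wvm₁≡1 (≡mod-trans Y≡βX (βX≡vX X))
              in  k , ≡mod-trans (≡⇒≡mod (*-identityˡ k)) k≡X , vk≡Y)
    (λ (k , 1k≡X , vk≡Y) →
       ≡mod-trans (line-point⇒≡mod v (ℕ.n∣m*n m₁) (ℕ.n∣m*n n₁)
                     (≡mod-trans (≡⇒≡mod (sym (*-identityˡ k))) 1k≡X) vk≡Y)
                  (≡mod-sym (βX≡vX X)))

isLineOn-congruenceLine-coprimeʳ : ∀ {m n m₁ n₁ p} .{{_ : NonZero m}} .{{_ : NonZero n}} →
  m ≡ m₁ ℕ.* p → n ≡ n₁ ℕ.* p → Coprime m₁ n₁ → Coprime p n₁ →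
  ∀ β → IsLineOn m n (CongruenceLine m n p β)
isLineOn-congruenceLine-coprimeʳ {m₁ = m₁} {n₁} {p} refl refl m₁⊥n₁ p⊥n₁ β =
  let v , v≡β , v≡1 = chinese-remainder p⊥n₁ β 1ℤ
      w , wm₁≡1     = coprime⇒invertible m₁⊥n₁
  in  isLineOn-congruenceLine-along {m₁} {n₁} {p} {β} {w} v v≡β v≡1 wm₁≡1

≡mod-flip : ∀ {p β β' X Y} → β' * β ≡ 1ℤ mod p → Y ≡ β * X mod p → X ≡ β' * Y mod p
≡mod-flip {p} {β} {β'} {X} {Y} β'β≡1 Y≡βX = begin
  X            ≡⟨ *-identityˡ X ⟨
  1ℤ * X       ≈⟨ *-congʳ-mod X (≡mod-sym β'β≡1) ⟩
  β' * β * X   ≡⟨ *-assoc β' β X ⟩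
  β' * (β * X) ≈⟨ *-congˡ-mod β' (≡mod-sym Y≡βX) ⟩
  β' * Y       ∎
  where open ≡mod-Reasoning p

congruenceLine-swap⇔ : ∀ {m n p β β' x y} → β' * β ≡ 1ℤ mod p →
  CongruenceLine m n p β (x , y) ⇔ CongruenceLine n m p β' (y , x)
congruenceLine-swap⇔ {p = p} {β} {β'} β'β≡1 = mk⇔
  (λ (x<m , y<n , y≡βx) → y<n , x<m , ≡mod-flip {β = β} {β'} β'β≡1 y≡βx)
  (λ (y<n , x<m , x≡β'y) → x<m , y<n , ≡mod-flip {β = β'} {β} ββ'≡1 x≡β'y)
  where
  ββ'≡1 : β * β' ≡ 1ℤ mod p
  ββ'≡1 = subst (λ t → t ≡ 1ℤ mod p) (*-comm β' β) β'β≡1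

isLineOn-congruenceLine : ∀ {m n m₁ n₁ p β} .{{_ : NonZero m}} .{{_ : NonZero n}} → Prime p →
  m ≡ m₁ ℕ.* p → n ≡ n₁ ℕ.* p → Coprime m₁ n₁ → ∃[ β' ] β' * β ≡ 1ℤ mod p →
  IsLineOn m n (CongruenceLine m n p β)
isLineOn-congruenceLine {m} {n} {m₁} {n₁} {p} {β} pr m≡m₁p n≡n₁p m₁⊥n₁ (β' , β'β≡1) =
  [ coprime-to-m₁ , coprime-to-n₁ ]′ (prime⇒coprime⊎coprime pr m₁⊥n₁)
  where
  coprime-to-n₁ : Coprime p n₁ → IsLineOn m n (CongruenceLine m n p β)
  coprime-to-n₁ p⊥n₁ = isLineOn-congruenceLine-coprimeʳ m≡m₁p n≡n₁p m₁⊥n₁ p⊥n₁ β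

  coprime-to-m₁ : Coprime p m₁ → IsLineOn m n (CongruenceLine m n p β)
  coprime-to-m₁ p⊥m₁ =
    isLineOn-resp-⇔ {m} {n} (λ (x , y) → ⇔-sym (congruenceLine-swap⇔ {m} {n} {p} {β} {β'} {x} {y} β'β≡1))
      (isLineOn-swap {n} {m} (isLineOn-congruenceLine-coprimeʳ n≡n₁p m≡m₁p (coprime-sym m₁⊥n₁) p⊥m₁ β'))

lemma4p3 : (m n p : ℕ) → 1 < m → 1 < n → gcd m n ≡ p → Prime p → p ≢ 2 →
           (β : ℕ) → 1 ≤ β → β < p →
           IsLineOn m n (ρ⁻¹ m n p (ℓ p β))
lemma4p3 m n p 1<m 1<n refl pr _ β 1≤β β<p =
  isLineOn-resp-⇔ {m} {n} (λ z → ⇔-sym (ρ⁻¹ℓ⇔congruenceLine {m} {n} {p} {β} z))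
    (isLineOn-congruenceLine {β = + β} pr m≡m/p*p n≡n/p*p (coprime-/gcd m n)
      (coprime⇒invertible (coprime-sym (prime⇒coprime pr β<p))))
  where
  instance
    _ = prime⇒nonZero pr
    _ = ≢-nonZero (m<n⇒n≢0 1<m)
    _ = ≢-nonZero (m<n⇒n≢0 1<n)
    _ = >-nonZero 1≤β

  m≡m/p*p : m ≡ m / p ℕ.* p
  m≡m/p*p = sym (m/n*n≡m (gcd[m,n]∣m m n))

  n≡n/p*p : n ≡ n / p ℕ.* p
  n≡n/p*p = sym (m/n*n≡m (gcd[m,n]∣n m n))
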